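{- Let $F=\begin{bmatrix}0&1&1\\1&0&1\end{bmatrix}$. Then $\mathrm{sat}(n,F)=\mathrm{forb}(n,F)=n+1$ for every $n\ge 2$.
   Context: All matrices are $0$-$1$ matrices. A matrix is simple if it has no repeated columns. A matrix $F$ is a submatrix of $A$ if, after deleting some rows and columns of $A$, one obtains a row and column permutation of $F$. $\mathrm{forb}(n,F)$ is the maximum number of columns of a simple $n$-row matrix not containing $F$ as a submatrix. A simple $n$-row matrix $M$ is $F$-saturated if it does not contain $F$ but appending any $n$-column not already a column of $M$ produces a matrix containing $F$; $\mathrm{sat}(n,F)$ is the minimum number of columns of an $F$-saturated $n$-row matrix. -}

module Defs where

open import Data.Bool using (Bool; true; false)
open import Data.Nat using (ℕ; _≤_)
open import Data.Fin using (Fin)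
open import Data.Vec using (Vec; lookup; _∷_; [])
open import Data.Vec.Membership.Propositional using (_∈_)
open import Data.Product using (Σ; ∃; _×_)
open import Relation.Binary.PropositionalEquality using (_≡_)
open import Relation.Nullary using (¬_)
open import Function.Definitions using (Injective)

-- A 0-1 matrix with n rows and m columns, stored as the vector of its columns.
Mat : ℕ → ℕ → Set
Mat n m = Vec (Vec Bool n) m

entry : ∀ {n m} → Mat n m → Fin n → Fin m → Bool
entry A i j = lookup (lookup A j) i

Simple : ∀ {n m} → Mat n m → Set
Simple A = Injective _≡_ _≡_ (lookup A)

-- F (k × l) is a submatrix of A (n × m): choose k distinct rows and l distinct
-- columns of A (in some order, which accounts for row/column permutations)
-- so that the selected entries agree with F.
Contains : ∀ {k l n m} → Mat n m → Mat k l → Set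
Contains {k} {l} {n} {m} A F =
  Σ (Fin k → Fin n) λ f → Σ (Fin l → Fin m) λ g →
    Injective _≡_ _≡_ f × Injective _≡_ _≡_ g ×
    (∀ i j → entry A (f i) (g j) ≡ entry F i j)

Avoids : ∀ {k l n m} → Mat k l → Mat n m → Set
Avoids F A = Simple A × ¬ Contains A F

Saturated : ∀ {k l n m} → Mat k l → Mat n m → Set
Saturated F A = Simple A × ¬ Contains A F ×
  (∀ v → ¬ (v ∈ A) → Contains (v ∷ A) F)

ForbIs : ∀ {k l} → Mat k l → ℕ → ℕ → Set
ForbIs F n N = Σ (Mat n N) (Avoids F) × (∀ m (A : Mat n m) → Avoids F A → m ≤ N)

SatIs : ∀ {k l} → Mat k l → ℕ → ℕ → Set
SatIs F n N = Σ (Mat n N) (Saturated F) × (∀ m (A : Mat n m) → Saturated F A → N ≤ m)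

F₀ : Mat 2 3
F₀ = (false ∷ true ∷ []) ∷ (true ∷ false ∷ []) ∷ (true ∷ true ∷ []) ∷ []

module Submission where

-- A matrix A contains F₀ exactly when it has a
-- *crossing*: two distinct rows a, b on which A shows the column patterns
-- (0,1), (1,0) and (1,1).  Reading rows as sets of columns, the (1,1) pattern
-- says the rows meet and the other two say neither contains the other; so A
-- avoids F₀ iff any two rows sharing a 1 are nested.
--
-- Upper bound (forb): in a simple crossing-free A each nonempty column is the
--   up-set (under row inclusion) of the ⊆-least row of its support, so a column
--   is determined by "empty, or its least row": at most n + 1 columns.
-- Lower bound (sat): if A is F₀-saturated, a column whose addition would create
--   no crossing must already be present.  This puts into A the empty column and,
--   for every row i, the up-set of i; saturation also makes row inclusion
--   antisymmetric, so these n + 1 columns are distinct.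
-- Both bounds are attained by the staircase matrix (columns 0, e₁, e₁+e₂, …),
-- whose rows form a chain and which is saturated.

open import Defs
open import Level using (0ℓ)
open import Data.Bool using (Bool; true; false)
open import Data.Bool.Properties using () renaming (_≟_ to _≟B_)
open import Data.Nat using (ℕ; suc; zero; _≤_)
open import Data.Fin using (Fin; zero; suc; fromℕ)
open import Data.Fin.Properties using (injective⇒≤; any?; all?)
  renaming (_≟_ to _≟F_; suc-injective to Fin-suc-injective)
open import Data.Vec using (Vec; lookup; _∷_; []; tabulate; replicate; map)
open import Data.Vec.Properties
  using (lookup∘tabulate; lookup-map; lookup-replicate; ∷-injectiveʳ; ≡-dec;
         tabulate∘lookup; tabulate-cong)
open import Data.Vec.Membership.Propositional using (_∈_)
open import Data.Vec.Membership.Propositional.Properties using (∈-map⁺)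
import Data.Vec.Membership.DecPropositional as DecMembership
open import Data.Vec.Relation.Unary.Any using (here; there; index)
open import Data.Vec.Relation.Unary.Any.Properties using (lookup-index)
open import Data.Product using (∃; ∃₂; _×_; _,_; proj₁; proj₂)
open import Data.Sum using (_⊎_; inj₁; inj₂)
open import Data.Empty using (⊥; ⊥-elim)
open import Relation.Binary.PropositionalEquality
open import Relation.Binary.Definitions using (Transitive)
open import Relation.Nullary using (¬_; Dec; yes; no; does; ¬?; _×-dec_; _→-dec_)
open import Relation.Nullary.Decidable using (dec-true)
open import Relation.Unary using (Pred; Decidable)
open import Function.Definitions using (Injective)

private variable
  n m : ℕ
  A : Mat n m
  a b : Fin n
  p q : Bool

true≢false : true ≢ false
true≢false ()

ones-ext : (u v : Vec Bool n) →
  (∀ i → lookup u i ≡ true → lookup v i ≡ true) →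
  (∀ i → lookup v i ≡ true → lookup u i ≡ true) → u ≡ v
ones-ext u v u⇒v v⇒u = begin
  u                   ≡⟨ sym (tabulate∘lookup u) ⟩
  tabulate (lookup u) ≡⟨ tabulate-cong (λ i → same (u⇒v i) (v⇒u i)) ⟩
  tabulate (lookup v) ≡⟨ tabulate∘lookup v ⟩
  v                   ∎
  where
  open ≡-Reasoning
  same : ∀ {x y} → (x ≡ true → y ≡ true) → (y ≡ true → x ≡ true) → x ≡ y
  same {true}  x⇒y _   = sym (x⇒y refl)
  same {false} {true}  _ y⇒x = y⇒x refl
  same {false} {false} _ _   = refl

indicator : {S : Pred (Fin n) 0ℓ} → Decidable S → Vec Bool n
indicator S? = tabulate (λ j → does (S? j))

indicator-true : {S : Pred (Fin n) 0ℓ} (S? : Decidable S) {j : Fin n} →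
  S j → lookup (indicator S?) j ≡ true
indicator-true S? {j} s = trans (lookup∘tabulate _ j) (dec-true (S? j) s)

indicator-sound : {S : Pred (Fin n) 0ℓ} (S? : Decidable S) {j : Fin n} →
  lookup (indicator S?) j ≡ true → S j
indicator-sound S? {j} e with S? j | lookup∘tabulate (λ j → does (S? j)) j
... | yes s | _    = s
... | no _  | look = ⊥-elim (true≢false (trans (sym e) look))

indicator-transfer : {S T : Pred (Fin n) 0ℓ} (S? : Decidable S) (T? : Decidable T) →
  indicator S? ≡ indicator T? → {j : Fin n} → S j → T j
indicator-transfer S? T? eq {j} s = indicator-sound T?
  (trans (sym (cong (λ column → lookup column j) eq)) (indicator-true S? s))

indicator-sound-false : {S : Pred (Fin n) 0ℓ} (S? : Decidable S) {j : Fin n} →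
  lookup (indicator S?) j ≡ false → ¬ S j
indicator-sound-false S? e s = true≢false (trans (sym (indicator-true S? s)) e)

_∈?_ : (v : Vec Bool n) (A : Mat n m) → Dec (v ∈ A)
v ∈? A = DecMembership._∈?_ (≡-dec _≟B_) v A

Shows : Mat n m → Fin n → Fin n → Bool → Bool → Set
Shows {m = m} A a b p q = ∃ λ (k : Fin m) → entry A a k ≡ p × entry A b k ≡ q

shows-swap : Shows A a b p q → Shows A b a q p
shows-swap (k , ea , eb) = k , eb , ea

shows? : (A : Mat n m) (a b : Fin n) (p q : Bool) → Dec (Shows A a b p q)
shows? A a b p q = any? (λ k → (entry A a k ≟B p) ×-dec (entry A b k ≟B q))

Crossing : Mat n m → Set
Crossing {n} A = ∃₂ λ (a b : Fin n) → a ≢ b ×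
  Shows A a b false true × Shows A a b true false × Shows A a b true true

contains⇒crossing : Contains A F₀ → Crossing A
contains⇒crossing (f , g , f-inj , _ , e) =
  f zero , f (suc zero) , (λ eq → 0≢1 (f-inj eq)) ,
  (g zero , e zero zero , e (suc zero) zero) ,
  (g (suc zero) , e zero (suc zero) , e (suc zero) (suc zero)) ,
  (g (suc (suc zero)) , e zero (suc (suc zero)) , e (suc zero) (suc (suc zero)))
  where
  0≢1 : zero ≢ suc {1} zero
  0≢1 ()

crossing⇒contains : Crossing A → Contains A F₀
crossing⇒contains {n} {m} {A} (a , b , a≢b , (k₁ , p₁ , q₁) , (k₂ , p₂ , q₂) , (k₃ , p₃ , q₃)) =
  rows , cols , rows-inj , cols-inj , agree
  where
  rows : Fin 2 → Fin n
  rows zero       = a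
  rows (suc zero) = b
  cols : Fin 3 → Fin m
  cols zero             = k₁
  cols (suc zero)       = k₂
  cols (suc (suc zero)) = k₃
  rows-inj : Injective _≡_ _≡_ rows
  rows-inj {zero}     {zero}     _  = refl
  rows-inj {zero}     {suc zero} eq = ⊥-elim (a≢b eq)
  rows-inj {suc zero} {zero}     eq = ⊥-elim (a≢b (sym eq))
  rows-inj {suc zero} {suc zero} _  = refl
  apart : ∀ {r k k'} → entry A r k ≡ true → entry A r k' ≡ false → k ≢ k'
  apart e e' refl = true≢false (trans (sym e) e')
  cols-inj : Injective _≡_ _≡_ cols
  cols-inj {zero}             {zero}             _  = refl
  cols-inj {zero}             {suc zero}         eq = ⊥-elim (apart q₁ q₂ eq)
  cols-inj {zero}             {suc (suc zero)}   eq = ⊥-elim (apart p₃ p₁ (sym eq))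
  cols-inj {suc zero}         {zero}             eq = ⊥-elim (apart q₁ q₂ (sym eq))
  cols-inj {suc zero}         {suc zero}         _  = refl
  cols-inj {suc zero}         {suc (suc zero)}   eq = ⊥-elim (apart q₃ q₂ (sym eq))
  cols-inj {suc (suc zero)}   {zero}             eq = ⊥-elim (apart p₃ p₁ eq)
  cols-inj {suc (suc zero)}   {suc zero}         eq = ⊥-elim (apart q₃ q₂ eq)
  cols-inj {suc (suc zero)}   {suc (suc zero)}   _  = refl
  agree : ∀ i j → entry A (rows i) (cols j) ≡ entry F₀ i j
  agree zero       zero             = p₁
  agree zero       (suc zero)       = p₂
  agree zero       (suc (suc zero)) = p₃
  agree (suc zero) zero             = q₁
  agree (suc zero) (suc zero)       = q₂
  agree (suc zero) (suc (suc zero)) = q₃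

_⊆[_]_ : Fin n → Mat n m → Fin n → Set
_⊆[_]_ {m = m} i A j = (k : Fin m) → entry A i k ≡ true → entry A j k ≡ true

⊆-refl : (i : Fin n) → i ⊆[ A ] i
⊆-refl i k e = e

⊆-trans : {i j l : Fin n} → i ⊆[ A ] j → j ⊆[ A ] l → i ⊆[ A ] l
⊆-trans i⊆j j⊆l k e = j⊆l k (i⊆j k e)

⊆? : (A : Mat n m) (i j : Fin n) → Dec (i ⊆[ A ] j)
⊆? A i j = all? (λ k → (entry A i k ≟B true) →-dec (entry A j k ≟B true))

forced-inclusion : ¬ Crossing A → Shows A a b false true → Shows A a b true true →
  a ⊆[ A ] b
forced-inclusion {A = A} {a} {b} no-crossing s₀₁ s₁₁ k ea with entry A b k in eb
... | true  = refl
... | false = ⊥-elim (no-crossing (a , b , a≢b , s₀₁ , (k , ea , eb) , s₁₁))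
  where
  a≢b : a ≢ b
  a≢b refl = true≢false (trans (sym ea) eb)

shared-one⇒nested : ¬ Crossing A → (k : Fin m) → entry A a k ≡ true → entry A b k ≡ true →
  a ⊆[ A ] b ⊎ b ⊆[ A ] a
shared-one⇒nested {A = A} {a = a} {b} no-crossing k ea eb with shows? A a b false true
... | yes s₀₁ = inj₁ (forced-inclusion {A = A} no-crossing s₀₁ (k , ea , eb))
... | no ¬s₀₁ = inj₂ b⊆a
  where
  b⊆a : b ⊆[ A ] a
  b⊆a k' eb' with entry A a k' in ea'
  ... | true  = refl
  ... | false = ⊥-elim (¬s₀₁ (k' , ea' , eb'))

nested⇒crossing-free : (∀ a b → a ⊆[ A ] b ⊎ b ⊆[ A ] a) → ¬ Crossing A
nested⇒crossing-free nested (a , b , _ , (k , ea , eb) , (k' , ea' , eb') , _) with nested a b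
... | inj₁ a⊆b = true≢false (trans (sym (a⊆b k' ea')) eb')
... | inj₂ b⊆a = true≢false (trans (sym (b⊆a k eb)) ea)

total⇒reflexive : ∀ {k} {P : Pred (Fin k) 0ℓ} {R : Fin k → Fin k → Set} →
  (∀ i j → P i → P j → R i j ⊎ R j i) → ∀ {i} → P i → R i i
total⇒reflexive total {i} pi with total i i pi pi
... | inj₁ r = r
... | inj₂ r = r

least : ∀ {k} (P : Pred (Fin k) 0ℓ) → Decidable P → (R : Fin k → Fin k → Set) →
  Transitive R → (∀ i j → P i → P j → R i j ⊎ R j i) →
  (∀ j → ¬ P j) ⊎ ∃ λ r → P r × (∀ j → P j → R r j)
least {zero}  P P? R trans-R total = inj₁ (λ ())
least {suc k} P P? R trans-R total
  with least (λ j → P (suc j)) (λ j → P? (suc j)) (λ i j → R (suc i) (suc j))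
             trans-R (λ i j → total (suc i) (suc j))
     | P? zero
... | inj₁ none | no ¬p₀ = inj₁ λ { zero → ¬p₀ ; (suc j) → none j }
... | inj₁ none | yes p₀ =
  inj₂ (zero , p₀ , λ { zero _ → total⇒reflexive total p₀ ; (suc j) pj → ⊥-elim (none j pj) })
... | inj₂ (r , pr , r-least) | no ¬p₀ =
  inj₂ (suc r , pr , λ { zero p₀ → ⊥-elim (¬p₀ p₀) ; (suc j) pj → r-least j pj })
... | inj₂ (r , pr , r-least) | yes p₀ with total zero (suc r) p₀ pr
...   | inj₂ r≤0 = inj₂ (suc r , pr , λ { zero _ → r≤0 ; (suc j) pj → r-least j pj })
...   | inj₁ 0≤r = inj₂ (zero , p₀ ,
          λ { zero _ → total⇒reflexive total p₀ ; (suc j) pj → trans-R 0≤r (r-least j pj) })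

Support : Mat n m → Fin m → Pred (Fin n) 0ℓ
Support A k j = entry A j k ≡ true

same-support : Simple A → {k k' : Fin m} →
  (∀ j → Support A k j → Support A k' j) → (∀ j → Support A k' j → Support A k j) → k ≡ k'
same-support simple k⇒k' k'⇒k = simple (ones-ext _ _ k⇒k' k'⇒k)

LeastRow : Mat n m → Fin m → Fin n → Set
LeastRow A k r = Support A k r × (∀ j → Support A k j → r ⊆[ A ] j)

ZeroOrLeast : Mat n m → Fin m → Set
ZeroOrLeast A k = (∀ j → ¬ Support A k j) ⊎ ∃ (LeastRow A k)

least-row : ¬ Crossing A → (k : Fin m) → ZeroOrLeast A k
least-row {A = A} no-crossing k =
  least (Support A k) (λ j → entry A j k ≟B true) (λ i j → i ⊆[ A ] j) (⊆-trans {A = A})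
        (λ i j ei ej → shared-one⇒nested {A = A} no-crossing k ei ej)

-- Upper bound: a simple crossing-free matrix has at most n + 1 columns, since
-- a column is determined by its code "zero, or suc of its least row"
-- (its support is exactly the up-set of the least row).
module ForbBound (A : Mat n m) (simple : Simple A) (no-crossing : ¬ Crossing A) where

  code : {k : Fin m} → ZeroOrLeast A k → Fin (suc n)
  code (inj₁ _)       = zero
  code (inj₂ (r , _)) = suc r

  column-code : Fin m → Fin (suc n)
  column-code k = code {k} (least-row {A = A} no-crossing k)

  same-code : {k k' : Fin m} (c : ZeroOrLeast A k) (c' : ZeroOrLeast A k') →
    code {k} c ≡ code {k'} c' → k ≡ k'
  same-code (inj₁ zero-k) (inj₁ zero-k') _ =
    same-support {A = A} simple (λ j e → ⊥-elim (zero-k j e)) (λ j e → ⊥-elim (zero-k' j e))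
  same-code {k} {k'} (inj₂ (r , er , r-least)) (inj₂ (.r , er' , r-least')) refl =
    same-support {A = A} simple (λ j e → r-least j e k' er') (λ j e → r-least' j e k er)

  forb-upper : m ≤ suc n
  forb-upper = injective⇒≤ {f = column-code} λ {k} {k'} →
    same-code (least-row {A = A} no-crossing k) (least-row {A = A} no-crossing k')

Covered : Mat n m → Pred (Fin n) 0ℓ → Set
Covered {n} A S = (a b : Fin n) → a ≢ b → S a → S b → Shows A a b true true

Separated : Mat n m → Pred (Fin n) 0ℓ → Set
Separated {n} A S = (a b : Fin n) → S a → ¬ S b →
  Shows A a b false true → Shows A a b true true → ⊥

shows-split : {v : Vec Bool n} → Shows (v ∷ A) a b p q →
  (lookup v a ≡ p × lookup v b ≡ q) ⊎ Shows A a b p q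
shows-split (zero  , ea , eb) = inj₁ (ea , eb)
shows-split (suc k , ea , eb) = inj₂ (k , ea , eb)

-- Appending the indicator column of a covered, separated set S to a
-- crossing-free matrix creates no crossing: the new column could only supply
-- the (1,1) pattern (excluded by coverage) or one of (0,1), (1,0) (excluded by
-- separation); it cannot supply two patterns at once.
extend-crossing-free : ¬ Crossing A → {S : Pred (Fin n) 0ℓ} (S? : Decidable S) →
  Covered A S → Separated A S → ¬ Crossing (indicator S? ∷ A)
extend-crossing-free {A = A} no-crossing S? covered separated (a , b , a≢b , s₀₁ , s₁₀ , s₁₁)
  with shows-split {A = A} s₀₁ | shows-split {A = A} s₁₀ | shows-split {A = A} s₁₁
... | inj₂ old₀₁ | inj₂ old₁₀ | inj₂ old₁₁ = no-crossing (a , b , a≢b , old₀₁ , old₁₀ , old₁₁)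
... | inj₂ old₀₁ | inj₂ old₁₀ | inj₁ (ea , eb) =
  no-crossing (a , b , a≢b , old₀₁ , old₁₀ ,
               covered a b a≢b (indicator-sound S? ea) (indicator-sound S? eb))
... | inj₂ old₀₁ | inj₁ (ea , eb) | inj₂ old₁₁ =
  separated a b (indicator-sound S? ea) (indicator-sound-false S? eb) old₀₁ old₁₁
... | inj₁ (ea , eb) | inj₂ old₁₀ | inj₂ old₁₁ =
  separated b a (indicator-sound S? eb) (indicator-sound-false S? ea)
            (shows-swap {A = A} old₁₀) (shows-swap {A = A} old₁₁)
... | inj₁ (ea , _) | inj₁ (ea' , _) | _              = true≢false (trans (sym ea') ea)
... | inj₁ (ea , _) | _              | inj₁ (ea' , _) = true≢false (trans (sym ea') ea)
... | _              | inj₁ (_ , eb) | inj₁ (_ , eb') = true≢false (trans (sym eb') eb)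

module SatBound (A : Mat n m) (no-crossing : ¬ Crossing A)
                (saturating : ∀ v → ¬ (v ∈ A) → Crossing (v ∷ A)) where

  realised : {S : Pred (Fin n) 0ℓ} (S? : Decidable S) → Covered A S → Separated A S →
    ∃ λ k → lookup A k ≡ indicator S?
  realised S? covered separated with indicator S? ∈? A
  ... | yes v∈A = index v∈A , sym (lookup-index v∈A)
  ... | no  v∉A = ⊥-elim (extend-crossing-free no-crossing S? covered separated (saturating _ v∉A))

  realised-entry : {S : Pred (Fin n) 0ℓ} (S? : Decidable S) {k : Fin m} →
    lookup A k ≡ indicator S? → ∀ j → entry A j k ≡ lookup (indicator S?) j
  realised-entry S? eq j = cong (λ column → lookup column j) eq

  -- Every row has a 1: otherwise the unit column at row i is covered and
  -- separated, so it would be a column of A with a 1 in row i.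
  row-has-one : (i : Fin n) → ∃ λ k → entry A i k ≡ true
  row-has-one i with any? (λ k → entry A i k ≟B true)
  ... | yes found = found
  ... | no  none  = ⊥-elim (none (k , trans (realised-entry unit? eq i) (indicator-true unit? refl)))
    where
    unit? : Decidable (λ j → j ≡ i)
    unit? j = j ≟F i
    covered : Covered A (λ j → j ≡ i)
    covered a b a≢b refl refl = ⊥-elim (a≢b refl)
    separated : Separated A (λ j → j ≡ i)
    separated a b refl _ _ (k' , ea , _) = none (k' , ea)
    k : Fin m
    k = proj₁ (realised unit? covered separated)
    eq : lookup A k ≡ indicator unit?
    eq = proj₂ (realised unit? covered separated)

  Up : Fin n → Pred (Fin n) 0ℓ
  Up i j = i ⊆[ A ] j

  up? : (i : Fin n) → Decidable (Up i)
  up? i = ⊆? A i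

  up-covered : (i : Fin n) → Covered A (Up i)
  up-covered i a b _ i⊆a i⊆b = let (k , e) = row-has-one i in k , i⊆a k e , i⊆b k e

  -- Up i is ⊆-upward closed, and (0,1),(1,1) on rows a, b force a ⊆ b.
  up-separated : (i : Fin n) → Separated A (Up i)
  up-separated i a b i⊆a i⊈b s₀₁ s₁₁ =
    i⊈b (⊆-trans {A = A} i⊆a (forced-inclusion {A = A} no-crossing s₀₁ s₁₁))

  -- Row inclusion is antisymmetric: if distinct rows had i ⊆ r ⊆ i, the column
  -- Up i ∖ {r} would be covered and separated, hence a column of A with a 1
  -- in row i but not in row r.
  ⊆-antisym : {i r : Fin n} → i ⊆[ A ] r → r ⊆[ A ] i → i ≡ r
  ⊆-antisym {i} {r} i⊆r r⊆i with i ≟F r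
  ... | yes i≡r = i≡r
  ... | no  i≢r = ⊥-elim (r∉W (indicator-sound W? (begin
          lookup (indicator W?) r ≡⟨ realised-entry W? eq r ⟨
          entry A r k              ≡⟨ i⊆r k i∈column ⟩
          true                     ∎)))
    where
    open ≡-Reasoning
    W : Pred (Fin n) 0ℓ
    W j = Up i j × j ≢ r
    W? : Decidable W
    W? j = up? i j ×-dec ¬? (j ≟F r)
    r∉W : ¬ W r
    r∉W (_ , r≢r) = r≢r refl
    covered : Covered A W
    covered a b a≢b (i⊆a , _) (i⊆b , _) = up-covered i a b a≢b i⊆a i⊆b
    separated : Separated A W
    separated a b (i⊆a , _) b∉W s₀₁ s₁₁ with b ≟F r
    ... | yes refl = let (y , ya , yr) = s₀₁ in true≢false (trans (sym (i⊆a y (r⊆i y yr))) ya)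
    ... | no  b≢r  = b∉W (⊆-trans {A = A} i⊆a (forced-inclusion {A = A} no-crossing s₀₁ s₁₁) , b≢r)
    k : Fin m
    k = proj₁ (realised W? covered separated)
    eq : lookup A k ≡ indicator W?
    eq = proj₂ (realised W? covered separated)
    i∈column : entry A i k ≡ true
    i∈column = trans (realised-entry W? eq i) (indicator-true W? (⊆-refl {A = A} i , i≢r))

  Family : Fin (suc n) → Pred (Fin n) 0ℓ
  Family zero    _ = ⊥
  Family (suc i)   = Up i

  family? : (x : Fin (suc n)) → Decidable (Family x)
  family? zero    _ = no (λ ())
  family? (suc i)   = up? i

  family-realised : (x : Fin (suc n)) → ∃ λ k → lookup A k ≡ indicator (family? x)
  family-realised zero    = realised (family? zero) (λ _ _ _ ()) (λ _ _ ())
  family-realised (suc i) = realised (up? i) (up-covered i) (up-separated i)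

  -- Distinct members of the family have distinct indicator columns
  -- (row i lies in Up i, and Up i = Up r forces i ⊆ r ⊆ i).
  family-injective : {x y : Fin (suc n)} → indicator (family? x) ≡ indicator (family? y) → x ≡ y
  family-injective {zero}  {zero}  _  = refl
  family-injective {zero}  {suc i} eq =
    ⊥-elim (indicator-transfer (up? i) (family? zero) (sym eq) (⊆-refl {A = A} i))
  family-injective {suc i} {zero}  eq =
    ⊥-elim (indicator-transfer (up? i) (family? zero) eq (⊆-refl {A = A} i))
  family-injective {suc i} {suc r} eq =
    cong suc (⊆-antisym (indicator-transfer (up? r) (up? i) (sym eq) (⊆-refl {A = A} r))
                        (indicator-transfer (up? i) (up? r) eq (⊆-refl {A = A} i)))

  sat-lower : suc n ≤ m
  sat-lower = injective⇒≤ {f = λ x → proj₁ (family-realised x)} λ {x} {y} eq →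
    family-injective (trans (sym (proj₂ (family-realised x)))
                     (trans (cong (lookup A) eq) (proj₂ (family-realised y))))

-- The staircase matrix: column k has its 1s exactly in the top k rows.
staircase : (n : ℕ) → Mat n (suc n)
staircase zero    = [] ∷ []
staircase (suc n) = replicate (suc n) false ∷ map (true ∷_) (staircase n)

staircase-first-column : ∀ n (i : Fin n) → entry (staircase n) i zero ≡ false
staircase-first-column (suc n) i = lookup-replicate i false

staircase-top : ∀ n (k : Fin (suc n)) → entry (staircase (suc n)) zero (suc k) ≡ true
staircase-top n k = cong (λ column → lookup column zero) (lookup-map k (true ∷_) (staircase n))

staircase-shift : ∀ n (i : Fin n) (k : Fin (suc n)) →
  entry (staircase (suc n)) (suc i) (suc k) ≡ entry (staircase n) i k
staircase-shift n i k = cong (λ column → lookup column (suc i)) (lookup-map k (true ∷_) (staircase n))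

staircase-last-column : ∀ n (i : Fin n) → entry (staircase n) i (fromℕ n) ≡ true
staircase-last-column (suc n) zero    = staircase-top n (fromℕ n)
staircase-last-column (suc n) (suc i) =
  trans (staircase-shift n i (fromℕ n)) (staircase-last-column n i)

staircase-simple : ∀ n → Simple (staircase n)
staircase-simple zero    {zero}  {zero}  _  = refl
staircase-simple (suc n) {zero}  {zero}  _  = refl
staircase-simple (suc n) {zero}  {suc k} eq =
  ⊥-elim (true≢false (trans (sym (staircase-top n k)) (cong (λ column → lookup column zero) (sym eq))))
staircase-simple (suc n) {suc k} {zero}  eq =
  ⊥-elim (true≢false (trans (sym (staircase-top n k)) (cong (λ column → lookup column zero) eq)))
staircase-simple (suc n) {suc k} {suc k'} eq = cong suc (staircase-simple n (∷-injectiveʳ (begin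
  true ∷ lookup (staircase n) k              ≡⟨ lookup-map k (true ∷_) (staircase n) ⟨
  lookup (map (true ∷_) (staircase n)) k     ≡⟨ eq ⟩
  lookup (map (true ∷_) (staircase n)) k'    ≡⟨ lookup-map k' (true ∷_) (staircase n) ⟩
  true ∷ lookup (staircase n) k'             ∎)))
  where open ≡-Reasoning

staircase-top-largest : ∀ n (j : Fin (suc n)) → j ⊆[ staircase (suc n) ] zero
staircase-top-largest n j zero    e =
  ⊥-elim (true≢false (trans (sym e) (staircase-first-column (suc n) j)))
staircase-top-largest n j (suc k) _ = staircase-top n k

staircase-shift-⊆ : ∀ n {a b : Fin n} → a ⊆[ staircase n ] b → suc a ⊆[ staircase (suc n) ] suc b
staircase-shift-⊆ n {a} a⊆b zero    e =
  ⊥-elim (true≢false (trans (sym e) (staircase-first-column (suc n) (suc a))))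
staircase-shift-⊆ n {a} {b} a⊆b (suc k) e =
  trans (staircase-shift n b k) (a⊆b k (trans (sym (staircase-shift n a k)) e))

staircase-nested : ∀ n (a b : Fin n) → a ⊆[ staircase n ] b ⊎ b ⊆[ staircase n ] a
staircase-nested (suc n) zero    b       = inj₂ (staircase-top-largest n b)
staircase-nested (suc n) a       zero    = inj₁ (staircase-top-largest n a)
staircase-nested (suc n) (suc a) (suc b) with staircase-nested n a b
... | inj₁ a⊆b = inj₁ (staircase-shift-⊆ n a⊆b)
... | inj₂ b⊆a = inj₂ (staircase-shift-⊆ n b⊆a)

staircase-shift-shows : ∀ n {a b : Fin n} → Shows (staircase n) a b p q →
  Shows (staircase (suc n)) (suc a) (suc b) p q
staircase-shift-shows n {a} {b} (k , ea , eb) =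
  suc k , trans (staircase-shift n a k) ea , trans (staircase-shift n b k) eb

-- An inversion of v: a 0 of v in a row a above a row b where v has a 1.  The
-- staircase then shows (1,0) and (1,1) on rows a, b, which together with v's
-- (0,1) is a crossing.
Inversion : ∀ n → Vec Bool n → Set
Inversion n v = ∃₂ λ (a b : Fin n) → a ≢ b × lookup v a ≡ false × lookup v b ≡ true ×
  Shows (staircase n) a b true false × Shows (staircase n) a b true true

-- Every column outside the staircase has an inversion (induction on n by the
-- first entry: a leading 0 is either the zero column or above some 1).
column-or-inversion : ∀ n (v : Vec Bool n) → v ∈ staircase n ⊎ Inversion n v
column-or-inversion zero    []          = inj₁ (here refl)
column-or-inversion (suc n) (false ∷ w) with any? (λ j → lookup w j ≟B true)
... | no  no-one = inj₁ (here (cong (false ∷_) (ones-ext w (replicate n false)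
        (λ j e → ⊥-elim (no-one (j , e)))
        (λ j e → ⊥-elim (true≢false (trans (sym e) (lookup-replicate j false)))))))
... | yes (b , wb) = inj₂ (zero , suc b , (λ ()) , refl , wb ,
        (suc zero , staircase-top n zero ,
          trans (staircase-shift n b zero) (staircase-first-column n b)) ,
        (suc (fromℕ n) , staircase-top n (fromℕ n) ,
          trans (staircase-shift n b (fromℕ n)) (staircase-last-column n b)))
column-or-inversion (suc n) (true ∷ w) with column-or-inversion n w
... | inj₁ w∈staircase = inj₁ (there (∈-map⁺ (true ∷_) w∈staircase))
... | inj₂ (a , b , a≢b , wa , wb , s₁₀ , s₁₁) =
  inj₂ (suc a , suc b , (λ eq → a≢b (Fin-suc-injective eq)) , wa , wb ,
        staircase-shift-shows n s₁₀ , staircase-shift-shows n s₁₁)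

staircase-saturated : ∀ n → Saturated F₀ (staircase n)
staircase-saturated n =
  staircase-simple n ,
  (λ contains → nested⇒crossing-free {A = staircase n} (staircase-nested n)
                  (contains⇒crossing {A = staircase n} contains)) ,
  (λ v v∉staircase → crossing⇒contains {A = v ∷ staircase n} (new-crossing v v∉staircase))
  where
  new-crossing : ∀ v → ¬ (v ∈ staircase n) → Crossing (v ∷ staircase n)
  new-crossing v v∉staircase with column-or-inversion n v
  ... | inj₁ v∈staircase = ⊥-elim (v∉staircase v∈staircase)
  ... | inj₂ (a , b , a≢b , va , vb , (k , ea , eb) , (k' , ea' , eb')) =
    a , b , a≢b , (zero , va , vb) , (suc k , ea , eb) , (suc k' , ea' , eb')

-- sat(n,F₀) = forb(n,F₀) = n + 1, witnessed by the staircase.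
mainTheorem11 : (n : ℕ) → 2 ≤ n → SatIs F₀ n (suc n) × ForbIs F₀ n (suc n)
mainTheorem11 n _ =
  ((staircase n , staircase-saturated n) , sat-lower-bound) ,
  ((staircase n , staircase-simple n , proj₁ (proj₂ (staircase-saturated n))) , forb-upper-bound)
  where
  sat-lower-bound : ∀ m (A : Mat n m) → Saturated F₀ A → suc n ≤ m
  sat-lower-bound m A (_ , avoids , saturates) =
    SatBound.sat-lower A (λ crossing → avoids (crossing⇒contains {A = A} crossing))
                         (λ v v∉A → contains⇒crossing {A = v ∷ A} (saturates v v∉A))
  forb-upper-bound : ∀ m (A : Mat n m) → Avoids F₀ A → m ≤ suc n
  forb-upper-bound m A (simple , avoids) =
    ForbBound.forb-upper A simple (λ crossing → avoids (crossing⇒contains {A = A} crossing))
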